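{- Let $\alpha,\beta,\gamma,e,f,g,h$ be nonnegative real numbers, and let $[A_{n,k}]_{n,k\geq 0}$ be defined by $A_{0,0}=1$, $A_{0,k}=0$ for $k>0$, and for $n\geq 1$: $$A_{n,0}=\alpha A_{n-1,0}+gA_{n-1,1}+hA_{n-1,2},\qquad A_{n,1}=\beta A_{n-1,0}+fA_{n-1,1}+gA_{n-1,2}+hA_{n-1,3},$$ $$A_{n,k}=\gamma A_{n-1,k-2}+eA_{n-1,k-1}+fA_{n-1,k}+gA_{n-1,k+1}+hA_{n-1,k+2}\quad (k\geq 2).$$ Suppose that (1) $f\geq \alpha$, $e\geq \beta$, $g\geq 0$ and $h\geq 0$; (2) $\alpha f\geq \beta g \geq \gamma h$ and $f^{2}\geq eg\geq \gamma h$; (3) $\alpha e\geq \gamma g$, $ef\geq \gamma g$ and $\beta f\geq \gamma g$; (4) $\beta e\geq \gamma f$, $\alpha g\geq \beta h$, $g^{2}\geq fh$ and $fg\geq eh$. Then the polynomials $A_{n}(q)=\sum_{k=0}^{2n}A_{n,k}q^{k}$, $n\geq 0$, form a strongly $q$-log-convex sequence.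
   Context: For real polynomials $F(q),G(q)$, write $F(q)\geq_q G(q)$ if $F(q)-G(q)$ has only nonnegative coefficients. A sequence of polynomials $(F_n(q))_{n\geq 0}$ is strongly $q$-log-convex if $F_{n}(q)F_{m}(q)\leq_{q} F_{n-1}(q)F_{m+1}(q)$ for all $m\geq n\geq 1$. -}

module Defs where

open import Level using (Level; _⊔_)
open import Data.Nat as ℕ using (ℕ; zero; suc)
import Data.Bool
open import Algebra.Bundles using (CommutativeRing)
open import Relation.Binary.Core using (Rel)
open import Relation.Binary.Structures using (IsTotalOrder)

-- A (totally) ordered commutative ring: the abstract setting standing in for ℝ
-- (no real numbers are available in agda-stdlib).  ℝ with its usual order is
-- an instance.
record OrderedCommutativeRing (c ℓ₁ ℓ₂ : Level) : Set (Level.suc (c ⊔ ℓ₁ ⊔ ℓ₂)) where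
  field
    commutativeRing : CommutativeRing c ℓ₁
  open CommutativeRing commutativeRing public
  infix 4 _≤_
  field
    _≤_          : Rel Carrier ℓ₂
    isTotalOrder : IsTotalOrder _≈_ _≤_
    +-monoˡ-≤    : ∀ {x y} z → x ≤ y → x + z ≤ y + z
    *-nonneg     : ∀ {x y} → 0# ≤ x → 0# ≤ y → 0# ≤ x * y

module _ {c ℓ₁ ℓ₂} (R : OrderedCommutativeRing c ℓ₁ ℓ₂) where
  open OrderedCommutativeRing R using (Carrier; _+_; _*_; _-_; 0#; 1#; _≤_)

  -- Polynomials are represented by their coefficient sequences ℕ → Carrier.

  -- Coefficient of q^j in the product F(q) G(q):  Σ_{i=0}^{j} F_i G_{j-i}.
  convAux : (ℕ → Carrier) → (ℕ → Carrier) → ℕ → ℕ → Carrier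
  convAux F G zero    j = F zero * G j
  convAux F G (suc i) j = F (suc i) * G j + convAux F G i (suc j)

  polyMul : (ℕ → Carrier) → (ℕ → Carrier) → ℕ → Carrier
  polyMul F G j = convAux F G j zero

  _≤q_ : (ℕ → Carrier) → (ℕ → Carrier) → Set ℓ₂
  F ≤q G = ∀ k → 0# ≤ G k - F k

  StronglyQLogConvex : (ℕ → ℕ → Carrier) → Set ℓ₂
  StronglyQLogConvex P =
    ∀ n m → 1 ℕ.≤ n → n ℕ.≤ m →
      polyMul (P n) (P m) ≤q polyMul (P (n ℕ.∸ 1)) (P (suc m))

  A : (α β γ e f g h : Carrier) → ℕ → ℕ → Carrier
  A α β γ e f g h zero zero    = 1#
  A α β γ e f g h zero (suc k) = 0#
  A α β γ e f g h (suc n) zero =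
    α * A α β γ e f g h n 0 + g * A α β γ e f g h n 1 + h * A α β γ e f g h n 2
  A α β γ e f g h (suc n) (suc zero) =
    β * A α β γ e f g h n 0 + f * A α β γ e f g h n 1
      + g * A α β γ e f g h n 2 + h * A α β γ e f g h n 3
  A α β γ e f g h (suc n) (suc (suc k)) =
    γ * A α β γ e f g h n k + e * A α β γ e f g h n (suc k)
      + f * A α β γ e f g h n (suc (suc k))
      + g * A α β γ e f g h n (suc (suc (suc k)))
      + h * A α β γ e f g h n (suc (suc (suc (suc k))))

  Apoly : (α β γ e f g h : Carrier) → ℕ → ℕ → Carrier
  Apoly α β γ e f g h n k with k ℕ.≤ᵇ 2 ℕ.* n
  ... | Data.Bool.true  = A α β γ e f g h n k
  ... | Data.Bool.false = 0#

-- Write the array as A_{n+1} = A_n P for its production matrix P (row 0 of P is (α, β, γ), the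
-- other rows are the band (h, g, f, e, γ)).  Condition (1) makes P nondecreasing along its diagonals,
-- and (2)-(4) make all its 2 × 2 minors nonnegative (P is TP₂).  TP₂ makes consecutive rows
-- ratio-ordered (A_{n+1,k} / A_{n,k} nondecreasing in k); diagonal monotonicity passes to the rows
-- e_t P^r of P^r.  With A_{n+r} = A_n P^r, the coefficients of q^S in A_{n+1} A_{n+r} and in
-- A_n A_{n+r+1} are the same bilinear form in (A_n, A_{n+1}) with mutually transposed kernels
-- (reflected rows of P^r), and pairing the (i, j) and (j, i) terms leaves a product
-- (q - p)(w₁ - w₂) of two nonnegative factors.

module Submission where

open import Defs
open import Data.Nat as ℕ using (ℕ; zero; suc; z≤n; s≤s)
import Data.Nat.Properties as ℕ
open import Data.Fin using (toℕ)
import Data.Fin.Properties as Fin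
open import Data.Bool using (true; false; T)
open import Data.Maybe using (nothing)
open import Data.Product using (∃-syntax; _,_)
open import Data.Sum using (inj₁; inj₂)
open import Relation.Binary.Bundles using (Poset)
open import Relation.Nullary using (yes; no)
open import Relation.Binary.Structures using (IsTotalOrder)
import Relation.Binary.PropositionalEquality as ≡
open ≡ using (_≡_)
open import Tactic.RingSolver.Core.AlmostCommutativeRing using (fromCommutativeRing)

module OrderedCommutativeRingProperties {c ℓ₁ ℓ₂} (R : OrderedCommutativeRing c ℓ₁ ℓ₂) where

  open OrderedCommutativeRing R
  open IsTotalOrder isTotalOrder public
    using (total; ≤-respˡ-≈; ≤-respʳ-≈) renaming (refl to ≤-refl; trans to ≤-trans)

  ≤-poset : Poset c ℓ₁ ℓ₂
  ≤-poset = record { isPartialOrder = IsTotalOrder.isPartialOrder isTotalOrder }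

  open import Relation.Binary.Reasoning.PartialOrder ≤-poset
  open import Algebra.Properties.Group +-group using (//-rightDividesˡ; ⁻¹-involutive)
  open import Algebra.Properties.Ring ring using ([y-z]x≈yx-zx; -‿distribˡ-*)
  open import Tactic.RingSolver.NonReflective (fromCommutativeRing commutativeRing (λ _ → nothing))
    using (solve; _⊕_; _⊗_; _⊜_)

  +-monoʳ-≤ : ∀ x {y z} → y ≤ z → x + y ≤ x + z
  +-monoʳ-≤ x {y} {z} y≤z = begin
    x + y  ≈⟨ +-comm x y ⟩
    y + x  ≤⟨ +-monoˡ-≤ x y≤z ⟩
    z + x  ≈⟨ +-comm z x ⟩
    x + z  ∎

  +-mono-≤ : ∀ {w x y z} → w ≤ x → y ≤ z → w + y ≤ x + z
  +-mono-≤ {x = x} {y} w≤x y≤z = ≤-trans (+-monoˡ-≤ y w≤x) (+-monoʳ-≤ x y≤z)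

  x≤y⇒0≤y-x : ∀ {x y} → x ≤ y → 0# ≤ y - x
  x≤y⇒0≤y-x {x} {y} x≤y = begin
    0#     ≈⟨ -‿inverseʳ x ⟨
    x - x  ≤⟨ +-monoˡ-≤ (- x) x≤y ⟩
    y - x  ∎

  0≤y-x⇒x≤y : ∀ {x y} → 0# ≤ y - x → x ≤ y
  0≤y-x⇒x≤y {x} {y} 0≤y-x = begin
    x             ≈⟨ +-identityˡ x ⟨
    0# + x        ≤⟨ +-monoˡ-≤ x 0≤y-x ⟩
    y - x + x     ≈⟨ //-rightDividesˡ x y ⟩
    y             ∎

  *-monoʳ-≤ : ∀ {x y z} → 0# ≤ x → y ≤ z → y * x ≤ z * x
  *-monoʳ-≤ {x} {y} {z} 0≤x y≤z = 0≤y-x⇒x≤y (begin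
    0#             ≤⟨ *-nonneg (x≤y⇒0≤y-x y≤z) 0≤x ⟩
    (z - y) * x    ≈⟨ [y-z]x≈yx-zx x z y ⟩
    z * x - y * x  ∎)

  *-monoˡ-≤ : ∀ {x y z} → 0# ≤ x → y ≤ z → x * y ≤ x * z
  *-monoˡ-≤ {x} {y} {z} 0≤x y≤z = begin
    x * y  ≈⟨ *-comm x y ⟩
    y * x  ≤⟨ *-monoʳ-≤ 0≤x y≤z ⟩
    z * x  ≈⟨ *-comm z x ⟩
    x * z  ∎

  *-mono-≤ : ∀ {w x y z} → 0# ≤ w → w ≤ x → 0# ≤ y → y ≤ z → w * y ≤ x * z
  *-mono-≤ 0≤w w≤x 0≤y y≤z = ≤-trans (*-monoʳ-≤ 0≤y w≤x) (*-monoˡ-≤ (≤-trans 0≤w w≤x) y≤z)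

  0≤1 : 0# ≤ 1#
  0≤1 with total 0# 1#
  ... | inj₁ 0≤1 = 0≤1
  ... | inj₂ 1≤0 = begin
    0#             ≤⟨ *-nonneg 0≤-1 0≤-1 ⟩
    - 1# * - 1#    ≈⟨ -‿distribˡ-* 1# (- 1#) ⟨
    - (1# * - 1#)  ≈⟨ -‿cong (*-identityˡ (- 1#)) ⟩
    - - 1#         ≈⟨ ⁻¹-involutive 1# ⟩
    1#             ∎
    where
    0≤-1 : 0# ≤ - 1#
    0≤-1 = ≤-respʳ-≈ (+-identityˡ (- 1#)) (x≤y⇒0≤y-x 1≤0)

  x+[y-x]≈y : ∀ x y → x + (y - x) ≈ y
  x+[y-x]≈y x y = trans (+-comm x (y - x)) (//-rightDividesˡ x y)

  rearrangement : ∀ {p q w₁ w₂} → p ≤ q → w₂ ≤ w₁ → p * w₁ + q * w₂ ≤ q * w₁ + p * w₂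
  rearrangement {p} {q} {w₁} {w₂} p≤q w₂≤w₁ = begin
    p * w₁ + q * w₂              ≈⟨ +-congˡ (*-congʳ (x+[y-x]≈y p q)) ⟨
    p * w₁ + (p + d) * w₂        ≈⟨ solve 4 (λ p d w₁ w₂ →
                                      (p ⊗ w₁ ⊕ (p ⊕ d) ⊗ w₂) ⊜ (p ⊗ w₁ ⊕ p ⊗ w₂ ⊕ d ⊗ w₂)) refl p d w₁ w₂ ⟩
    p * w₁ + p * w₂ + d * w₂     ≤⟨ +-monoʳ-≤ (p * w₁ + p * w₂) (*-monoˡ-≤ (x≤y⇒0≤y-x p≤q) w₂≤w₁) ⟩
    p * w₁ + p * w₂ + d * w₁     ≈⟨ solve 4 (λ p d w₁ w₂ →
                                      (p ⊗ w₁ ⊕ p ⊗ w₂ ⊕ d ⊗ w₁) ⊜ ((p ⊕ d) ⊗ w₁ ⊕ p ⊗ w₂)) refl p d w₁ w₂ ⟩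
    (p + d) * w₁ + p * w₂        ≈⟨ +-congʳ (*-congʳ (x+[y-x]≈y p q)) ⟩
    q * w₁ + p * w₂              ∎
    where d = q - p

  zeroˡ-≤ : ∀ {x y} → 0# ≤ y → 0# * x ≤ y
  zeroˡ-≤ {x} = ≤-respˡ-≈ (sym (zeroˡ x))

  zeroʳ-≤ : ∀ {x y} → 0# ≤ y → x * 0# ≤ y
  zeroʳ-≤ {x} = ≤-respˡ-≈ (sym (zeroʳ x))


module FiniteSums {c ℓ₁ ℓ₂} (R : OrderedCommutativeRing c ℓ₁ ℓ₂) where

  open OrderedCommutativeRing R
  open OrderedCommutativeRingProperties R
  open import Relation.Binary.Reasoning.PartialOrder ≤-poset
  open import Algebra.Properties.Semiring.Sum semiring using (sum; sum-cong-≋; sum-cong-≗;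
    sum-replicate-zero; sum-init-last; ∑-distrib-+; ∑-comm; *-distribˡ-sum; *-distribʳ-sum)
  open import Tactic.RingSolver.NonReflective (fromCommutativeRing commutativeRing (λ _ → nothing))
    using (solve; _⊕_; _⊗_; _⊜_)

  VanishesFrom : ℕ → (ℕ → Carrier) → Set ℓ₁
  VanishesFrom N v = ∀ k → N ℕ.≤ k → v k ≈ 0#

  ∑< : ℕ → (ℕ → Carrier) → Carrier
  ∑< n f = sum {n} (λ i → f (toℕ i))

  ∑<-cong : ∀ n {f g : ℕ → Carrier} → (∀ i → f i ≈ g i) → ∑< n f ≈ ∑< n g
  ∑<-cong n f≈g = sum-cong-≋ {n} (λ i → f≈g (toℕ i))

  ∑<-zero : ∀ n {f} → (∀ i → f i ≈ 0#) → ∑< n f ≈ 0#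
  ∑<-zero n f≈0 = trans (∑<-cong n f≈0) (sum-replicate-zero n)

  ∑<-mono-≤ : ∀ n {f g} → (∀ i → f i ≤ g i) → ∑< n f ≤ ∑< n g
  ∑<-mono-≤ zero    f≤g = ≤-refl
  ∑<-mono-≤ (suc n) f≤g = +-mono-≤ (f≤g 0) (∑<-mono-≤ n (λ i → f≤g (suc i)))

  ∑<-nonNeg : ∀ n {f} → (∀ i → 0# ≤ f i) → 0# ≤ ∑< n f
  ∑<-nonNeg n 0≤f = ≤-respˡ-≈ (∑<-zero n (λ _ → refl)) (∑<-mono-≤ n 0≤f)

  ∑<-last : ∀ n f → ∑< (suc n) f ≈ ∑< n f + f n
  ∑<-last n f = trans (sum-init-last {n} (λ i → f (toℕ i)))
    (+-cong (reflexive (sum-cong-≗ {n} (λ i → ≡.cong f (Fin.toℕ-inject₁ i))))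
            (reflexive (≡.cong f (Fin.toℕ-fromℕ n))))

  vanishesFrom-≤ : ∀ {M N v} → M ℕ.≤ N → VanishesFrom M v → VanishesFrom N v
  vanishesFrom-≤ M≤N v≈0 k N≤k = v≈0 k (ℕ.≤-trans M≤N N≤k)

  ∑<-vanishesFrom : ∀ {m n f} → m ℕ.≤ n → VanishesFrom m f → ∑< n f ≈ ∑< m f
  ∑<-vanishesFrom {n = n} z≤n f≈0 = ∑<-zero n (λ i → f≈0 i z≤n)
  ∑<-vanishesFrom (s≤s m≤n) f≈0 = +-congˡ (∑<-vanishesFrom m≤n (λ i m≤i → f≈0 (suc i) (s≤s m≤i)))

  ∑<-distrib-+ : ∀ n f g → ∑< n (λ i → f i + g i) ≈ ∑< n f + ∑< n g
  ∑<-distrib-+ n f g = ∑-distrib-+ {n} (λ i → f (toℕ i)) (λ i → g (toℕ i))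

  ∑<-comm : ∀ m n (f : ℕ → ℕ → Carrier) →
            ∑< m (λ i → ∑< n (f i)) ≈ ∑< n (λ j → ∑< m (λ i → f i j))
  ∑<-comm m n f = ∑-comm {m} {n} (λ i j → f (toℕ i) (toℕ j))

  *-distribˡ-∑< : ∀ n x f → x * ∑< n f ≈ ∑< n (λ i → x * f i)
  *-distribˡ-∑< n x f = *-distribˡ-sum {n} x (λ i → f (toℕ i))

  *-distribʳ-∑< : ∀ n x f → ∑< n f * x ≈ ∑< n (λ i → f i * x)
  *-distribʳ-∑< n x f = *-distribʳ-sum {n} x (λ i → f (toℕ i))

  ∑<-*-∑< : ∀ m n f g → ∑< m f * ∑< n g ≈ ∑< m (λ i → ∑< n (λ j → f i * g j))
  ∑<-*-∑< m n f g =
    trans (*-distribʳ-sum {m} (∑< n g) (λ i → f (toℕ i))) (∑<-cong m (λ i → *-distribˡ-∑< n (f i) g))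

  δ : ℕ → ℕ → Carrier
  δ zero    zero    = 1#
  δ zero    (suc _) = 0#
  δ (suc _) zero    = 0#
  δ (suc t) (suc s) = δ t s

  δ-nonNeg : ∀ t s → 0# ≤ δ t s
  δ-nonNeg zero    zero    = 0≤1
  δ-nonNeg zero    (suc _) = ≤-refl
  δ-nonNeg (suc _) zero    = ≤-refl
  δ-nonNeg (suc t) (suc s) = δ-nonNeg t s

  ∑<-δ : ∀ N {v} → VanishesFrom N v → ∀ s → ∑< N (λ t → v t * δ t s) ≈ v s
  ∑<-δ zero    v≈0 s       = sym (v≈0 s z≤n)
  ∑<-δ (suc N) {v} v≈0 zero    =
    trans (+-cong (*-identityʳ (v 0)) (∑<-zero N (λ t → zeroʳ (v (suc t))))) (+-identityʳ (v 0))
  ∑<-δ (suc N) {v} v≈0 (suc s) =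
    trans (+-cong (zeroʳ (v 0)) (∑<-δ N (λ k N≤k → v≈0 (suc k) (s≤s N≤k)) s)) (+-identityˡ (v (suc s)))

  ∑∑-suc : ∀ N (a : ℕ → ℕ → Carrier) →
           ∑< (suc N) (λ i → ∑< (suc N) (a i))
           ≈ a 0 0 + ∑< N (λ j → a 0 (suc j) + a (suc j) 0)
                   + ∑< N (λ i → ∑< N (λ j → a (suc i) (suc j)))
  ∑∑-suc N a = begin-equality
    a 0 0 + ∑< N (λ j → a 0 (suc j)) + ∑< N (λ i → a (suc i) 0 + ∑< N (λ j → a (suc i) (suc j)))
      ≈⟨ +-congˡ (∑<-distrib-+ N (λ i → a (suc i) 0) (λ i → ∑< N (λ j → a (suc i) (suc j)))) ⟩
    a 0 0 + ∑< N (λ j → a 0 (suc j)) + (∑< N (λ j → a (suc j) 0) + ∑∑′)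
      ≈⟨ solve 4 (λ x y z w → (x ⊕ y ⊕ (z ⊕ w)) ⊜ (x ⊕ (y ⊕ z) ⊕ w)) refl _ _ _ _ ⟩
    a 0 0 + (∑< N (λ j → a 0 (suc j)) + ∑< N (λ j → a (suc j) 0)) + ∑∑′
      ≈⟨ +-congʳ (+-congˡ (∑<-distrib-+ N (λ j → a 0 (suc j)) (λ j → a (suc j) 0))) ⟨
    a 0 0 + ∑< N (λ j → a 0 (suc j) + a (suc j) 0) + ∑∑′
      ∎
    where ∑∑′ = ∑< N (λ i → ∑< N (λ j → a (suc i) (suc j)))

  ∑∑-≤-pairwise : ∀ N (a b : ℕ → ℕ → Carrier) →
                  (∀ i → a i i ≤ b i i) →
                  (∀ i d → a i (i ℕ.+ suc d) + a (i ℕ.+ suc d) i ≤ b i (i ℕ.+ suc d) + b (i ℕ.+ suc d) i) →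
                  ∑< N (λ i → ∑< N (a i)) ≤ ∑< N (λ i → ∑< N (b i))
  ∑∑-≤-pairwise zero    a b diag pair = ≤-refl
  ∑∑-≤-pairwise (suc N) a b diag pair =
    ≤-respˡ-≈ (sym (∑∑-suc N a)) (≤-respʳ-≈ (sym (∑∑-suc N b))
      (+-mono-≤ (+-mono-≤ (diag 0) (∑<-mono-≤ N (pair 0)))
                (∑∑-≤-pairwise N (λ i j → a (suc i) (suc j)) (λ i j → b (suc i) (suc j))
                               (λ i → diag (suc i)) (λ i → pair (suc i)))))

  RatioIncreasing : (x y : ℕ → Carrier) → Set ℓ₂
  RatioIncreasing x y = ∀ i d → x (i ℕ.+ suc d) * y i ≤ x i * y (i ℕ.+ suc d)

  TP₂ : (ℕ → ℕ → Carrier) → Set ℓ₂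
  TP₂ K = ∀ i m k n → K i (k ℕ.+ suc n) * K (i ℕ.+ suc m) k ≤ K i k * K (i ℕ.+ suc m) (k ℕ.+ suc n)

  bilinear-rearrangement : ∀ N {x y} (K : ℕ → ℕ → Carrier) → RatioIncreasing x y →
                           (∀ i d → K i (i ℕ.+ suc d) ≤ K (i ℕ.+ suc d) i) →
                           ∑< N (λ i → ∑< N (λ j → x i * y j * K i j))
                           ≤ ∑< N (λ i → ∑< N (λ j → x i * y j * K j i))
  bilinear-rearrangement N {x} {y} K x≼y K≤Kᵀ =
    ∑∑-≤-pairwise N (λ i j → x i * y j * K i j) (λ i j → x i * y j * K j i) (λ _ → ≤-refl)
    (λ i d → ≤-respˡ-≈ (+-comm _ _) (rearrangement (x≼y i d) (K≤Kᵀ i d)))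


module Polynomials {c ℓ₁ ℓ₂} (R : OrderedCommutativeRing c ℓ₁ ℓ₂) where

  open OrderedCommutativeRing R
  open OrderedCommutativeRingProperties R
  open FiniteSums R
  open import Relation.Binary.Reasoning.PartialOrder ≤-poset

  convAux-cong : ∀ {F F′ G G′} → (∀ k → F k ≈ F′ k) → (∀ k → G k ≈ G′ k) →
                 ∀ i j → convAux R F G i j ≈ convAux R F′ G′ i j
  convAux-cong F≈F′ G≈G′ zero    j = *-cong (F≈F′ 0) (G≈G′ j)
  convAux-cong F≈F′ G≈G′ (suc i) j = +-cong (*-cong (F≈F′ (suc i)) (G≈G′ j)) (convAux-cong F≈F′ G≈G′ i (suc j))

  polyMul-cong : ∀ {F F′ G G′} → (∀ k → F k ≈ F′ k) → (∀ k → G k ≈ G′ k) →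
                 ∀ S → polyMul R F G S ≈ polyMul R F′ G′ S
  polyMul-cong F≈F′ G≈G′ S = convAux-cong F≈F′ G≈G′ S 0

  StronglyQLogConvex-cong : ∀ {A B} → (∀ n k → A n k ≈ B n k) →
                            StronglyQLogConvex R A → StronglyQLogConvex R B
  StronglyQLogConvex-cong A≈B convex n m 1≤n n≤m k = ≤-respʳ-≈
    (+-cong (polyMul-cong (A≈B (n ℕ.∸ 1)) (A≈B (suc m)) k) (-‿cong (polyMul-cong (A≈B n) (A≈B m) k)))
    (convex n m 1≤n n≤m k)

  reflect : ℕ → (ℕ → Carrier) → ℕ → Carrier
  reflect S       G zero    = G S
  reflect zero    G (suc t) = 0#
  reflect (suc S) G (suc t) = reflect S G t

  reflect-diagonal : ∀ G i j → reflect (i ℕ.+ j) G i ≡ G j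
  reflect-diagonal G zero    j = ≡.refl
  reflect-diagonal G (suc i) j = reflect-diagonal G i j

  reflect-vanishesFrom : ∀ S G → VanishesFrom (suc S) (reflect S G)
  reflect-vanishesFrom zero    G (suc t) _         = refl
  reflect-vanishesFrom (suc S) G (suc t) (s≤s S<t) = reflect-vanishesFrom S G t S<t

  reflect-cong : ∀ S {G H} → (∀ s → G s ≈ H s) → ∀ t → reflect S G t ≈ reflect S H t
  reflect-cong S       G≈H zero    = G≈H S
  reflect-cong zero    G≈H (suc t) = refl
  reflect-cong (suc S) G≈H (suc t) = reflect-cong S G≈H t

  reflect-∑< : ∀ S N (c : ℕ → Carrier) (H : ℕ → ℕ → Carrier) t →
               reflect S (λ s → ∑< N (λ u → c u * H u s)) t ≈ ∑< N (λ u → c u * reflect S (H u) t)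
  reflect-∑< S       N c H zero    = refl
  reflect-∑< zero    N c H (suc t) = sym (∑<-zero N (λ u → zeroʳ (c u)))
  reflect-∑< (suc S) N c H (suc t) = reflect-∑< S N c H t

  reflect-shift-≤ : ∀ S d {G H} → (∀ s → 0# ≤ H s) → (∀ s → G s ≤ H (d ℕ.+ s)) →
                    ∀ t → reflect S G (t ℕ.+ d) ≤ reflect S H t
  reflect-shift-≤ S       d {G} {H} 0≤H G≤H zero    = at-origin S d {G} {H} 0≤H G≤H
    where
    at-origin : ∀ S d {G H} → (∀ s → 0# ≤ H s) → (∀ s → G s ≤ H (d ℕ.+ s)) → reflect S G d ≤ H S
    at-origin S       zero    0≤H G≤H = G≤H S
    at-origin zero    (suc d) 0≤H G≤H = 0≤H 0
    at-origin (suc S) (suc d) {G} {H} 0≤H G≤H = at-origin S d {G} {λ s → H (suc s)} (λ s → 0≤H (suc s)) G≤H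
  reflect-shift-≤ zero    d 0≤H G≤H (suc t) = ≤-refl
  reflect-shift-≤ (suc S) d 0≤H G≤H (suc t) = reflect-shift-≤ S d 0≤H G≤H t

  convAux-∑< : ∀ F G i j → convAux R F G i j ≈ ∑< (suc i) (λ t → F t * reflect (i ℕ.+ j) G t)
  convAux-∑< F G zero    j = sym (+-identityʳ (F 0 * G j))
  convAux-∑< F G (suc i) j = begin-equality
    F (suc i) * G j + convAux R F G i (suc j)
      ≈⟨ +-congˡ (convAux-∑< F G i (suc j)) ⟩
    F (suc i) * G j + ∑< (suc i) (λ t → F t * reflect (i ℕ.+ suc j) G t)
      ≡⟨ ≡.cong (λ S → F (suc i) * G j + ∑< (suc i) (λ t → F t * reflect S G t)) (ℕ.+-suc i j) ⟩
    F (suc i) * G j + ∑< (suc i) (λ t → F t * reflect (suc i ℕ.+ j) G t)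
      ≈⟨ +-comm _ _ ⟩
    ∑< (suc i) (λ t → F t * reflect (suc i ℕ.+ j) G t) + F (suc i) * G j
      ≡⟨ ≡.cong (λ x → ∑< (suc i) (λ t → F t * reflect (suc i ℕ.+ j) G t) + F (suc i) * x)
                (reflect-diagonal G (suc i) j) ⟨
    ∑< (suc i) (λ t → F t * reflect (suc i ℕ.+ j) G t) + F (suc i) * reflect (suc i ℕ.+ j) G (suc i)
      ≈⟨ ∑<-last (suc i) (λ t → F t * reflect (suc i ℕ.+ j) G t) ⟨
    ∑< (suc (suc i)) (λ t → F t * reflect (suc i ℕ.+ j) G t)
      ∎

  polyMul-∑< : ∀ F G S {N} → S ℕ.< N → polyMul R F G S ≈ ∑< N (λ t → F t * reflect S G t)
  polyMul-∑< F G S {N} S<N = begin-equality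
    convAux R F G S 0                                 ≈⟨ convAux-∑< F G S 0 ⟩
    ∑< (suc S) (λ t → F t * reflect (S ℕ.+ 0) G t)    ≡⟨ ≡.cong (λ S′ → ∑< (suc S) (λ t → F t * reflect S′ G t))
                                                                (ℕ.+-identityʳ S) ⟩
    ∑< (suc S) (λ t → F t * reflect S G t)            ≈⟨ ∑<-vanishesFrom S<N (λ t S<t →
                                                           trans (*-congˡ (reflect-vanishesFrom S G t S<t))
                                                                 (zeroʳ (F t))) ⟨
    ∑< N (λ t → F t * reflect S G t)                  ∎


module ProductionMatrices {c ℓ₁ ℓ₂} (R : OrderedCommutativeRing c ℓ₁ ℓ₂)
                          (P : ℕ → ℕ → OrderedCommutativeRing.Carrier R) (b : ℕ) where

  open OrderedCommutativeRing R
  open OrderedCommutativeRingProperties R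
  open FiniteSums R
  open Polynomials R
  open import Relation.Binary.Reasoning.PartialOrder ≤-poset
  open import Algebra.Properties.CommutativeSemigroup *-commutativeSemigroup using (interchange; x∙yz≈y∙xz)
  open import Tactic.RingSolver.NonReflective (fromCommutativeRing commutativeRing (λ _ → nothing))
    using (solve; _⊕_; _⊗_; _⊜_)

  LowerBanded : Set ℓ₁
  LowerBanded = ∀ i s → b ℕ.+ s ℕ.≤ i → P i s ≈ 0#

  NonNegative : Set ℓ₂
  NonNegative = ∀ i s → 0# ≤ P i s

  DiagonallyIncreasing : Set ℓ₂
  DiagonallyIncreasing = ∀ i s → P i s ≤ P (suc i) (suc s)

  infixl 7 _·P _·P^_

  -- v P truncated to the rows i < s + b; it is the full product only when P is LowerBanded.
  _·P : (ℕ → Carrier) → ℕ → Carrier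
  (v ·P) s = ∑< (s ℕ.+ b) (λ i → v i * P i s)

  _·P^_ : (ℕ → Carrier) → ℕ → ℕ → Carrier
  v ·P^ zero  = v
  v ·P^ suc r = (v ·P^ r) ·P

  ·P-cong : ∀ {u v} → (∀ i → u i ≈ v i) → ∀ s → (u ·P) s ≈ (v ·P) s
  ·P-cong {u} {v} u≈v s = ∑<-cong (s ℕ.+ b) {λ i → u i * P i s} (λ i → *-congʳ (u≈v i))

  ·P^-nonNeg : NonNegative → ∀ {v} → (∀ i → 0# ≤ v i) → ∀ r s → 0# ≤ (v ·P^ r) s
  ·P^-nonNeg 0≤P 0≤v zero    = 0≤v
  ·P^-nonNeg 0≤P 0≤v (suc r) s =
    ∑<-nonNeg (s ℕ.+ b) (λ i → *-nonneg (·P^-nonNeg 0≤P 0≤v r i) (0≤P i s))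

  ·P-extend : LowerBanded → ∀ v s {L} → s ℕ.+ b ℕ.≤ L → ∑< L (λ i → v i * P i s) ≈ (v ·P) s
  ·P-extend banded v s s+b≤L = ∑<-vanishesFrom s+b≤L (λ i s+b≤i →
    trans (*-congˡ (banded i s (≡.subst (ℕ._≤ i) (ℕ.+-comm s b) s+b≤i))) (zeroʳ (v i)))

  ·P^-linear : ∀ {N v} → VanishesFrom N v → ∀ r s → (v ·P^ r) s ≈ ∑< N (λ t → v t * (δ t ·P^ r) s)
  ·P^-linear {N} v≈0 zero    s = sym (∑<-δ N v≈0 s)
  ·P^-linear {N} {v} v≈0 (suc r) s = begin-equality
    ((v ·P^ r) ·P) s
      ≈⟨ ·P-cong (·P^-linear v≈0 r) s ⟩
    ∑< (s ℕ.+ b) (λ i → ∑< N (λ t → v t * W t i) * P i s)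
      ≈⟨ ∑<-cong (s ℕ.+ b) (λ i → trans (*-distribʳ-∑< N (P i s) (λ t → v t * W t i))
                                         (∑<-cong N (λ t → *-assoc (v t) (W t i) (P i s)))) ⟩
    ∑< (s ℕ.+ b) (λ i → ∑< N (λ t → v t * (W t i * P i s)))
      ≈⟨ ∑<-comm (s ℕ.+ b) N (λ i t → v t * (W t i * P i s)) ⟩
    ∑< N (λ t → ∑< (s ℕ.+ b) (λ i → v t * (W t i * P i s)))
      ≈⟨ ∑<-cong N (λ t → *-distribˡ-∑< (s ℕ.+ b) (v t) (λ i → W t i * P i s)) ⟨
    ∑< N (λ t → v t * (δ t ·P^ suc r) s)
      ∎
    where
    W : ℕ → ℕ → Carrier
    W t = δ t ·P^ r

  RatioIncreasing-cong : ∀ {x x′ y y′} → (∀ i → x i ≈ x′ i) → (∀ i → y i ≈ y′ i) →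
                         RatioIncreasing x y → RatioIncreasing x′ y′
  RatioIncreasing-cong x≈x′ y≈y′ x≼y i d =
    ≤-respˡ-≈ (*-cong (x≈x′ _) (y≈y′ i)) (≤-respʳ-≈ (*-cong (x≈x′ i) (y≈y′ _)) (x≼y i d))

  ratioIncreasing-·P : LowerBanded → TP₂ P → ∀ {x y} → RatioIncreasing x y → RatioIncreasing (x ·P) (y ·P)
  ratioIncreasing-·P banded tp₂ {x} {y} x≼y k d = begin
    (x ·P) l * (y ·P) k
      ≈⟨ *-cong (·P-extend banded x l ℕ.≤-refl) (·P-extend banded y k k+b≤L) ⟨
    ∑< L (λ i → x i * P i l) * ∑< L (λ j → y j * P j k)
      ≈⟨ ∑<-*-∑< L L (λ i → x i * P i l) (λ j → y j * P j k) ⟩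
    ∑< L (λ i → ∑< L (λ j → x i * P i l * (y j * P j k)))
      ≈⟨ ∑<-cong L (λ i → ∑<-cong L (λ j → interchange (x i) (P i l) (y j) (P j k))) ⟩
    ∑< L (λ i → ∑< L (λ j → x i * y j * (P i l * P j k)))
      ≤⟨ bilinear-rearrangement L (λ i j → P i l * P j k) x≼y
           (λ i m → ≤-respʳ-≈ (*-comm _ _) (tp₂ i m k d)) ⟩
    ∑< L (λ i → ∑< L (λ j → x i * y j * (P j l * P i k)))
      ≈⟨ ∑<-cong L (λ i → ∑<-cong L (λ j → solve 4 (λ xi yj Pjl Pik →
           (xi ⊗ yj ⊗ (Pjl ⊗ Pik)) ⊜ (xi ⊗ Pik ⊗ (yj ⊗ Pjl))) refl (x i) (y j) (P j l) (P i k))) ⟩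
    ∑< L (λ i → ∑< L (λ j → x i * P i k * (y j * P j l)))
      ≈⟨ ∑<-*-∑< L L (λ i → x i * P i k) (λ j → y j * P j l) ⟨
    ∑< L (λ i → x i * P i k) * ∑< L (λ j → y j * P j l)
      ≈⟨ *-cong (·P-extend banded x k k+b≤L) (·P-extend banded y l ℕ.≤-refl) ⟩
    (x ·P) k * (y ·P) l
      ∎
    where
    l L : ℕ
    l = k ℕ.+ suc d
    L = l ℕ.+ b
    k+b≤L : k ℕ.+ b ℕ.≤ L
    k+b≤L = ℕ.+-monoˡ-≤ b (ℕ.m≤m+n k (suc d))

  ·P-diagonallyIncreasing : NonNegative → DiagonallyIncreasing →
                  ∀ {u v} → (∀ i → 0# ≤ u i) → (∀ i → 0# ≤ v i) → (∀ i → u i ≤ v (suc i)) →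
                  ∀ s → (u ·P) s ≤ (v ·P) (suc s)
  ·P-diagonallyIncreasing 0≤P P≤P {u} {v} 0≤u 0≤v u≤v s = begin
    (u ·P) s
      ≤⟨ ∑<-mono-≤ (s ℕ.+ b) (λ i → *-mono-≤ (0≤u i) (u≤v i) (0≤P i s) (P≤P i s)) ⟩
    ∑< (s ℕ.+ b) (λ i → v (suc i) * P (suc i) (suc s))
      ≈⟨ +-identityˡ _ ⟨
    0# + ∑< (s ℕ.+ b) (λ i → v (suc i) * P (suc i) (suc s))
      ≤⟨ +-monoˡ-≤ _ (*-nonneg (0≤v 0) (0≤P 0 (suc s))) ⟩
    (v ·P) (suc s)
      ∎

  δ-·P^-shift-≤ : NonNegative → DiagonallyIncreasing →
                  ∀ r d t s → (δ t ·P^ r) s ≤ (δ (d ℕ.+ t) ·P^ r) (d ℕ.+ s)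
  δ-·P^-shift-≤ 0≤P P≤P r zero    t s = ≤-refl
  δ-·P^-shift-≤ 0≤P P≤P r (suc d) t s =
    ≤-trans (δ-·P^-shift-≤ 0≤P P≤P r d t s) (diagonal r (d ℕ.+ t) (d ℕ.+ s))
    where
    diagonal : ∀ r t s → (δ t ·P^ r) s ≤ (δ (suc t) ·P^ r) (suc s)
    diagonal zero    t = λ s → ≤-refl
    diagonal (suc r) t = ·P-diagonallyIncreasing 0≤P P≤P (·P^-nonNeg 0≤P (δ-nonNeg t) r)
                                       (·P^-nonNeg 0≤P (δ-nonNeg (suc t)) r) (diagonal r t)

  polyMul-·P^ : ∀ {N} u {v} → VanishesFrom N v → ∀ r S → S ℕ.< N →
                polyMul R u (v ·P^ r) S ≈ ∑< N (λ i → u i * ∑< N (λ t → v t * reflect S (δ t ·P^ r) i))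
  polyMul-·P^ {N} u {v} v≈0 r S S<N = trans (polyMul-∑< u (v ·P^ r) S S<N)
    (∑<-cong N {λ i → u i * reflect S (v ·P^ r) i} (λ i → *-congˡ
      (trans (reflect-cong S (·P^-linear v≈0 r) i) (reflect-∑< S N v (λ t → δ t ·P^ r) i))))

  reflect-δ-·P^-≤ : NonNegative → DiagonallyIncreasing → ∀ r S i d →
                    reflect S (δ i ·P^ r) (i ℕ.+ suc d) ≤ reflect S (δ (i ℕ.+ suc d) ·P^ r) i
  reflect-δ-·P^-≤ 0≤P P≤P r S i d =
    reflect-shift-≤ S (suc d) (·P^-nonNeg 0≤P (δ-nonNeg (i ℕ.+ suc d)) r) shifted i
    where
    shifted : ∀ s → (δ i ·P^ r) s ≤ (δ (i ℕ.+ suc d) ·P^ r) (suc d ℕ.+ s)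
    shifted s = ≡.subst (λ j → (δ i ·P^ r) s ≤ (δ j ·P^ r) (suc d ℕ.+ s))
                        (ℕ.+-comm (suc d) i) (δ-·P^-shift-≤ 0≤P P≤P r (suc d) i s)

  polyMul-·P^-≤ : NonNegative → DiagonallyIncreasing →
                  ∀ {N x y} → RatioIncreasing x y → VanishesFrom N x → VanishesFrom N y →
                  ∀ r S → S ℕ.< N → polyMul R y (x ·P^ r) S ≤ polyMul R x (y ·P^ r) S
  polyMul-·P^-≤ 0≤P P≤P {N} {x} {y} x≼y x≈0 y≈0 r S S<N = begin
    polyMul R y (x ·P^ r) S
      ≈⟨ polyMul-·P^ y x≈0 r S S<N ⟩
    ∑< N (λ i → y i * ∑< N (λ t → x t * K t i))
      ≈⟨ ∑<-cong N (λ i → *-distribˡ-∑< N (y i) (λ t → x t * K t i)) ⟩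
    ∑< N (λ i → ∑< N (λ t → y i * (x t * K t i)))
      ≈⟨ ∑<-comm N N (λ i t → y i * (x t * K t i)) ⟩
    ∑< N (λ t → ∑< N (λ i → y i * (x t * K t i)))
      ≈⟨ ∑<-cong N (λ t → ∑<-cong N (λ i →
           trans (x∙yz≈y∙xz (y i) (x t) (K t i)) (sym (*-assoc (x t) (y i) (K t i))))) ⟩
    ∑< N (λ t → ∑< N (λ i → x t * y i * K t i))
      ≤⟨ bilinear-rearrangement N K x≼y (reflect-δ-·P^-≤ 0≤P P≤P r S) ⟩
    ∑< N (λ t → ∑< N (λ i → x t * y i * K i t))
      ≈⟨ ∑<-cong N (λ t → trans (∑<-cong N (λ i → *-assoc (x t) (y i) (K i t)))
                                 (sym (*-distribˡ-∑< N (x t) (λ i → y i * K i t)))) ⟩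
    ∑< N (λ t → x t * ∑< N (λ i → y i * K i t))
      ≈⟨ polyMul-·P^ x y≈0 r S S<N ⟨
    polyMul R x (y ·P^ r) S
      ∎
    where
    K : ℕ → ℕ → Carrier
    K t = reflect S (δ t ·P^ r)

  module Rows (a : ℕ → ℕ → Carrier) (a-step : ∀ n s → a (suc n) s ≈ (a n ·P) s) where

    rows-·P^ : ∀ n r s → a (n ℕ.+ r) s ≈ (a n ·P^ r) s
    rows-·P^ n zero    s = reflexive (≡.cong (λ m → a m s) (ℕ.+-identityʳ n))
    rows-·P^ n (suc r) s = begin-equality
      a (n ℕ.+ suc r) s      ≡⟨ ≡.cong (λ m → a m s) (ℕ.+-suc n r) ⟩
      a (suc (n ℕ.+ r)) s    ≈⟨ a-step (n ℕ.+ r) s ⟩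
      (a (n ℕ.+ r) ·P) s     ≈⟨ ·P-cong (rows-·P^ n r) s ⟩
      (a n ·P^ suc r) s      ∎

    rows-ratioIncreasing : LowerBanded → TP₂ P → RatioIncreasing (a 0) (a 1) →
                           ∀ n → RatioIncreasing (a n) (a (suc n))
    rows-ratioIncreasing banded tp₂ a₀≼a₁ zero    = a₀≼a₁
    rows-ratioIncreasing banded tp₂ a₀≼a₁ (suc n) =
      RatioIncreasing-cong (λ s → sym (a-step n s)) (λ s → sym (a-step (suc n) s))
        (ratioIncreasing-·P banded tp₂ (rows-ratioIncreasing banded tp₂ a₀≼a₁ n))

    rows-polyMul-≤ : NonNegative → LowerBanded → TP₂ P → DiagonallyIncreasing →
                     RatioIncreasing (a 0) (a 1) → (∀ n → ∃[ N ] VanishesFrom N (a n)) →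
                     ∀ n r S → polyMul R (a (suc n)) (a (n ℕ.+ r)) S ≤ polyMul R (a n) (a (suc n ℕ.+ r)) S
    rows-polyMul-≤ 0≤P banded tp₂ P≤P a₀≼a₁ finite n r S with finite n | finite (suc n)
    ... | Nx , x≈0 | Ny , y≈0 = begin
      polyMul R (a (suc n)) (a (n ℕ.+ r)) S
        ≈⟨ polyMul-cong (λ _ → refl) (rows-·P^ n r) S ⟩
      polyMul R (a (suc n)) (a n ·P^ r) S
        ≤⟨ polyMul-·P^-≤ 0≤P P≤P (rows-ratioIncreasing banded tp₂ a₀≼a₁ n)
             (vanishesFrom-≤ (ℕ.≤-trans (ℕ.m≤m+n Nx Ny) Nx+Ny≤N) x≈0)
             (vanishesFrom-≤ (ℕ.≤-trans (ℕ.m≤n+m Ny Nx) Nx+Ny≤N) y≈0) r S (ℕ.m≤m+n (suc S) (Nx ℕ.+ Ny)) ⟩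
      polyMul R (a n) (a (suc n) ·P^ r) S
        ≈⟨ polyMul-cong (λ _ → refl) (rows-·P^ (suc n) r) S ⟨
      polyMul R (a n) (a (suc n ℕ.+ r)) S
        ∎
      where
      Nx+Ny≤N : Nx ℕ.+ Ny ℕ.≤ suc S ℕ.+ (Nx ℕ.+ Ny)
      Nx+Ny≤N = ℕ.m≤n+m (Nx ℕ.+ Ny) (suc S)

    stronglyQLogConvex : NonNegative → LowerBanded → TP₂ P → DiagonallyIncreasing →
                         RatioIncreasing (a 0) (a 1) → (∀ n → ∃[ N ] VanishesFrom N (a n)) →
                         StronglyQLogConvex R a
    stronglyQLogConvex 0≤P banded tp₂ P≤P a₀≼a₁ finite (suc n) m _ n<m S =
      x≤y⇒0≤y-x (≡.subst (λ j → polyMul R (a (suc n)) (a j) S ≤ polyMul R (a n) (a (suc j)) S)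
                         (ℕ.m+[n∸m]≡n (ℕ.<⇒≤ n<m))
                         (rows-polyMul-≤ 0≤P banded tp₂ P≤P a₀≼a₁ finite n (m ℕ.∸ n) S))


module Array {c ℓ₁ ℓ₂} (R : OrderedCommutativeRing c ℓ₁ ℓ₂)
             (α β γ e f g h : OrderedCommutativeRing.Carrier R) where

  open OrderedCommutativeRing R
  open OrderedCommutativeRingProperties R
  open FiniteSums R
  open import Relation.Binary.Reasoning.PartialOrder ≤-poset
  open import Tactic.RingSolver.NonReflective (fromCommutativeRing commutativeRing (λ _ → nothing))
    using (solve; _⊕_; _⊗_; _⊜_)

  firstRow : ℕ → Carrier
  firstRow 0 = α
  firstRow 1 = β
  firstRow 2 = γ
  firstRow _ = 0#

  -- toeplitz i k = c (i + 3 - k) for c = (γ, e, f, g, h), and 0 outside this band.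
  toeplitz : ℕ → ℕ → Carrier
  toeplitz (suc i) (suc k) = toeplitz i k
  toeplitz 0 0 = g
  toeplitz 1 0 = h
  toeplitz 0 1 = f
  toeplitz 0 2 = e
  toeplitz 0 3 = γ
  toeplitz _ _ = 0#

  P : ℕ → ℕ → Carrier
  P zero    = firstRow
  P (suc i) = toeplitz i

  open ProductionMatrices R P 3

  a : ℕ → ℕ → Carrier
  a = A R α β γ e f g h

  P-column-shift : ∀ i k → P i (2 ℕ.+ k) ≡ P (suc i) (3 ℕ.+ k)
  P-column-shift zero    zero    = ≡.refl
  P-column-shift zero    (suc k) = ≡.refl
  P-column-shift (suc i) k       = ≡.refl

  ·P-column-2+ : ∀ v k → (v ·P) (2 ℕ.+ k) ≈
    γ * v k + e * v (1 ℕ.+ k) + f * v (2 ℕ.+ k) + g * v (3 ℕ.+ k) + h * v (4 ℕ.+ k)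
  ·P-column-2+ v zero = begin-equality
    v 0 * γ + (v 1 * e + (v 2 * f + (v 3 * g + (v 4 * h + 0#))))
      ≈⟨ +-congˡ (+-congˡ (+-congˡ (+-congˡ (+-identityʳ (v 4 * h))))) ⟩
    v 0 * γ + (v 1 * e + (v 2 * f + (v 3 * g + v 4 * h)))
      ≈⟨ solve 10 (λ γ e f g h v₀ v₁ v₂ v₃ v₄ →
           (v₀ ⊗ γ ⊕ (v₁ ⊗ e ⊕ (v₂ ⊗ f ⊕ (v₃ ⊗ g ⊕ v₄ ⊗ h))))
           ⊜ (γ ⊗ v₀ ⊕ e ⊗ v₁ ⊕ f ⊗ v₂ ⊕ g ⊗ v₃ ⊕ h ⊗ v₄)) refl γ e f g h (v 0) (v 1) (v 2) (v 3) (v 4) ⟩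
    γ * v 0 + e * v 1 + f * v 2 + g * v 3 + h * v 4
      ∎
  ·P-column-2+ v (suc k) = begin-equality
    v 0 * 0# + ∑< (2 ℕ.+ k ℕ.+ 3) (λ i → v (suc i) * P (suc i) (3 ℕ.+ k))
      ≈⟨ +-congʳ (zeroʳ (v 0)) ⟩
    0# + ∑< (2 ℕ.+ k ℕ.+ 3) (λ i → v (suc i) * P (suc i) (3 ℕ.+ k))
      ≈⟨ +-identityˡ _ ⟩
    ∑< (2 ℕ.+ k ℕ.+ 3) (λ i → v (suc i) * P (suc i) (3 ℕ.+ k))
      ≈⟨ ∑<-cong (2 ℕ.+ k ℕ.+ 3) (λ i → reflexive (≡.cong (v (suc i) *_) (P-column-shift i k))) ⟨
    ((λ i → v (suc i)) ·P) (2 ℕ.+ k)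
      ≈⟨ ·P-column-2+ (λ i → v (suc i)) k ⟩
    γ * v (1 ℕ.+ k) + e * v (2 ℕ.+ k) + f * v (3 ℕ.+ k) + g * v (4 ℕ.+ k) + h * v (5 ℕ.+ k)
      ∎

  a-step : ∀ n s → a (suc n) s ≈ (a n ·P) s
  a-step n zero = begin-equality
    α * a n 0 + g * a n 1 + h * a n 2
      ≈⟨ solve 6 (λ α g h x₀ x₁ x₂ → (α ⊗ x₀ ⊕ g ⊗ x₁ ⊕ h ⊗ x₂) ⊜ (x₀ ⊗ α ⊕ (x₁ ⊗ g ⊕ x₂ ⊗ h)))
              refl α g h (a n 0) (a n 1) (a n 2) ⟩
    a n 0 * α + (a n 1 * g + a n 2 * h)
      ≈⟨ +-congˡ (+-congˡ (+-identityʳ (a n 2 * h))) ⟨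
    (a n ·P) 0
      ∎
  a-step n (suc zero) = begin-equality
    β * a n 0 + f * a n 1 + g * a n 2 + h * a n 3
      ≈⟨ solve 8 (λ β f g h x₀ x₁ x₂ x₃ →
           (β ⊗ x₀ ⊕ f ⊗ x₁ ⊕ g ⊗ x₂ ⊕ h ⊗ x₃) ⊜ (x₀ ⊗ β ⊕ (x₁ ⊗ f ⊕ (x₂ ⊗ g ⊕ x₃ ⊗ h))))
              refl β f g h (a n 0) (a n 1) (a n 2) (a n 3) ⟩
    a n 0 * β + (a n 1 * f + (a n 2 * g + a n 3 * h))
      ≈⟨ +-congˡ (+-congˡ (+-congˡ (+-identityʳ (a n 3 * h)))) ⟨
    (a n ·P) 1
      ∎
  a-step n (suc (suc k)) = sym (·P-column-2+ (a n) k)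

  toeplitz-lower : ∀ i s → 2 ℕ.+ s ℕ.≤ i → toeplitz i s ≡ 0#
  toeplitz-lower _       zero    (s≤s (s≤s _)) = ≡.refl
  toeplitz-lower (suc i) (suc s) (s≤s 2+s≤i)   = toeplitz-lower i s 2+s≤i

  P-lowerBanded : LowerBanded
  P-lowerBanded (suc i) s (s≤s 2+s≤i) = reflexive (toeplitz-lower i s 2+s≤i)

  toeplitz-upper : ∀ i s → 4 ℕ.+ i ℕ.≤ s → toeplitz i s ≡ 0#
  toeplitz-upper zero    _       (s≤s (s≤s (s≤s (s≤s _)))) = ≡.refl
  toeplitz-upper (suc i) (suc s) (s≤s 4+i≤s)               = toeplitz-upper i s 4+i≤s

  P-upperBanded : ∀ i s → 3 ℕ.+ i ℕ.≤ s → P i s ≡ 0#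
  P-upperBanded zero    _ (s≤s (s≤s (s≤s _))) = ≡.refl
  P-upperBanded (suc i) s 4+i≤s               = toeplitz-upper i s 4+i≤s

  ·P-vanishesFrom : ∀ {N v} → VanishesFrom N v → VanishesFrom (2 ℕ.+ N) (v ·P)
  ·P-vanishesFrom {N} {v} v≈0 s 2+N≤s = ∑<-zero (s ℕ.+ 3) term≈0
    where
    term≈0 : ∀ i → v i * P i s ≈ 0#
    term≈0 i with i ℕ.<? N
    ... | yes i<N = trans (*-congˡ (reflexive (P-upperBanded i s (ℕ.≤-trans (s≤s (s≤s i<N)) 2+N≤s))))
                          (zeroʳ (v i))
    ... | no  i≮N = trans (*-congʳ (v≈0 i (ℕ.≮⇒≥ i≮N))) (zeroˡ (P i s))

  a-vanishesFrom : ∀ n → VanishesFrom (suc (2 ℕ.* n)) (a n)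
  a-vanishesFrom zero    (suc k) _       = refl
  a-vanishesFrom (suc n) k       2n+3≤k  = trans (a-step n k) (·P-vanishesFrom (a-vanishesFrom n) k
    (≡.subst (λ j → suc j ℕ.≤ k) (ℕ.*-suc 2 n) 2n+3≤k))

  Apoly≈a : ∀ n k → Apoly R α β γ e f g h n k ≈ a n k
  Apoly≈a n k with k ℕ.≤ᵇ 2 ℕ.* n in eq
  ... | true  = refl
  ... | false = sym (a-vanishesFrom n k (ℕ.≰⇒> (λ k≤2n → ≡.subst T eq (ℕ.≤⇒≤ᵇ k≤2n))))

  module NonNegativeEntries (0≤α : 0# ≤ α) (0≤β : 0# ≤ β) (0≤γ : 0# ≤ γ) (0≤e : 0# ≤ e)
                            (0≤f : 0# ≤ f) (0≤g : 0# ≤ g) (0≤h : 0# ≤ h) where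

    firstRow-nonNeg : ∀ k → 0# ≤ firstRow k
    firstRow-nonNeg 0                   = 0≤α
    firstRow-nonNeg 1                   = 0≤β
    firstRow-nonNeg 2                   = 0≤γ
    firstRow-nonNeg (suc (suc (suc _))) = ≤-refl

    toeplitz-nonNeg : ∀ i k → 0# ≤ toeplitz i k
    toeplitz-nonNeg (suc i)       (suc k)                   = toeplitz-nonNeg i k
    toeplitz-nonNeg 0             0                         = 0≤g
    toeplitz-nonNeg 1             0                         = 0≤h
    toeplitz-nonNeg (suc (suc _)) 0                         = ≤-refl
    toeplitz-nonNeg 0             1                         = 0≤f
    toeplitz-nonNeg 0             2                         = 0≤e
    toeplitz-nonNeg 0             3                         = 0≤γ
    toeplitz-nonNeg 0             (suc (suc (suc (suc _)))) = ≤-refl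

    P-nonNeg : NonNegative
    P-nonNeg zero    = firstRow-nonNeg
    P-nonNeg (suc i) = toeplitz-nonNeg i

    a-nonNeg : ∀ n k → 0# ≤ a n k
    a-nonNeg zero    zero    = 0≤1
    a-nonNeg zero    (suc k) = ≤-refl
    a-nonNeg (suc n) k       = ≤-respʳ-≈ (sym (a-step n k)) (·P^-nonNeg P-nonNeg (a-nonNeg n) 1 k)

    a₀≼a₁ : RatioIncreasing (a 0) (a 1)
    a₀≼a₁ zero    d = zeroˡ-≤ (*-nonneg (a-nonNeg 0 0) (a-nonNeg 1 (suc d)))
    a₀≼a₁ (suc i) d = zeroˡ-≤ (*-nonneg (a-nonNeg 0 (suc i)) (a-nonNeg 1 (suc i ℕ.+ suc d)))

    module TotallyPositive
      (β≤e : β ≤ e) (βg≤αf : β * g ≤ α * f) (γh≤βg : γ * h ≤ β * g) (eg≤ff : e * g ≤ f * f)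
      (γh≤eg : γ * h ≤ e * g) (γg≤αe : γ * g ≤ α * e) (γg≤ef : γ * g ≤ e * f) (γg≤βf : γ * g ≤ β * f)
      (γf≤βe : γ * f ≤ β * e) (βh≤αg : β * h ≤ α * g) (fh≤gg : f * h ≤ g * g) (eh≤fg : e * h ≤ f * g)
      where

      private
        toeplitz-rhs : ∀ i m k n → 0# ≤ toeplitz i k * toeplitz (i ℕ.+ suc m) (k ℕ.+ suc n)
        toeplitz-rhs i m k n = *-nonneg (toeplitz-nonNeg i k) (toeplitz-nonNeg (i ℕ.+ suc m) (k ℕ.+ suc n))

        firstRow-rhs : ∀ m k n → 0# ≤ firstRow k * toeplitz m (k ℕ.+ suc n)
        firstRow-rhs m k n = *-nonneg (firstRow-nonNeg k) (toeplitz-nonNeg m (k ℕ.+ suc n))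

      toeplitz-TP₂ : TP₂ toeplitz
      toeplitz-TP₂ (suc i) m (suc k) n               = toeplitz-TP₂ i m k n
      toeplitz-TP₂ 0 0 0 0                           = fh≤gg
      toeplitz-TP₂ 0 0 0 1                           = ≤-respʳ-≈ (*-comm f g) eh≤fg
      toeplitz-TP₂ 0 0 0 2                           = ≤-respʳ-≈ (*-comm e g) γh≤eg
      toeplitz-TP₂ 0 0 0 n@(suc (suc (suc _)))       = zeroˡ-≤ (toeplitz-rhs 0 0 0 n)
      toeplitz-TP₂ 0 m@(suc _) 0 n                   = zeroʳ-≤ (toeplitz-rhs 0 m 0 n)
      toeplitz-TP₂ 1 m 0 n                           = zeroʳ-≤ (toeplitz-rhs 1 m 0 n)
      toeplitz-TP₂ i@(suc (suc _)) m 0 n             = zeroʳ-≤ (toeplitz-rhs i m 0 n)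
      toeplitz-TP₂ 0 0 1 0                           = eg≤ff
      toeplitz-TP₂ 0 1 1 0                           = eh≤fg
      toeplitz-TP₂ 0 m@(suc (suc _)) 1 0             = zeroʳ-≤ (toeplitz-rhs 0 m 1 0)
      toeplitz-TP₂ 0 0 1 1                           = ≤-respʳ-≈ (*-comm e f) γg≤ef
      toeplitz-TP₂ 0 1 1 1                           = ≤-trans γh≤eg eg≤ff
      toeplitz-TP₂ 0 m@(suc (suc _)) 1 1             = zeroʳ-≤ (toeplitz-rhs 0 m 1 1)
      toeplitz-TP₂ 0 m 1 n@(suc (suc _))             = zeroˡ-≤ (toeplitz-rhs 0 m 1 n)
      toeplitz-TP₂ 0 0 2 0                           = ≤-trans γf≤βe (*-monoʳ-≤ 0≤e β≤e)
      toeplitz-TP₂ 0 1 2 0                           = γg≤ef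
      toeplitz-TP₂ 0 2 2 0                           = γh≤eg
      toeplitz-TP₂ 0 m@(suc (suc (suc _))) 2 0       = zeroʳ-≤ (toeplitz-rhs 0 m 2 0)
      toeplitz-TP₂ 0 m 2 n@(suc _)                   = zeroˡ-≤ (toeplitz-rhs 0 m 2 n)
      toeplitz-TP₂ 0 m 3 n                           = zeroˡ-≤ (toeplitz-rhs 0 m 3 n)
      toeplitz-TP₂ 0 m k@(suc (suc (suc (suc _)))) n = zeroˡ-≤ (toeplitz-rhs 0 m k n)

      firstRow-minor : ∀ m k n → firstRow (k ℕ.+ suc n) * toeplitz m k ≤ firstRow k * toeplitz m (k ℕ.+ suc n)
      firstRow-minor 0 0 0                     = βg≤αf
      firstRow-minor 1 0 0                     = βh≤αg
      firstRow-minor m@(suc (suc _)) 0 0       = zeroʳ-≤ (firstRow-rhs m 0 0)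
      firstRow-minor 0 0 1                     = γg≤αe
      firstRow-minor 1 0 1                     = ≤-trans γh≤βg βg≤αf
      firstRow-minor m@(suc (suc _)) 0 1       = zeroʳ-≤ (firstRow-rhs m 0 1)
      firstRow-minor m 0 n@(suc (suc _))       = zeroˡ-≤ (firstRow-rhs m 0 n)
      firstRow-minor 0 1 0                     = γf≤βe
      firstRow-minor 1 1 0                     = γg≤βf
      firstRow-minor 2 1 0                     = γh≤βg
      firstRow-minor m@(suc (suc (suc _))) 1 0 = zeroʳ-≤ (firstRow-rhs m 1 0)
      firstRow-minor m 1 n@(suc _)             = zeroˡ-≤ (firstRow-rhs m 1 n)
      firstRow-minor m 2 n                     = zeroˡ-≤ (firstRow-rhs m 2 n)
      firstRow-minor m k@(suc (suc (suc _))) n = zeroˡ-≤ (firstRow-rhs m k n)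

      P-TP₂ : TP₂ P
      P-TP₂ zero    m k n = firstRow-minor m k n
      P-TP₂ (suc i) m k n = toeplitz-TP₂ i m k n

  P-diagonallyIncreasing : α ≤ f → β ≤ e → DiagonallyIncreasing
  P-diagonallyIncreasing α≤f β≤e zero    0                   = α≤f
  P-diagonallyIncreasing α≤f β≤e zero    1                   = β≤e
  P-diagonallyIncreasing α≤f β≤e zero    2                   = ≤-refl
  P-diagonallyIncreasing α≤f β≤e zero    (suc (suc (suc _))) = ≤-refl
  P-diagonallyIncreasing α≤f β≤e (suc i) s                   = ≤-refl


mainTheorem3 : ∀ {c ℓ₁ ℓ₂} (R : OrderedCommutativeRing c ℓ₁ ℓ₂) →
    let open OrderedCommutativeRing R in
    (α β γ e f g h : Carrier) →
    0# ≤ α → 0# ≤ β → 0# ≤ γ → 0# ≤ e → 0# ≤ f → 0# ≤ g → 0# ≤ h →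
    -- (1)
    α ≤ f → β ≤ e → 0# ≤ g → 0# ≤ h →
    -- (2)
    β * g ≤ α * f → γ * h ≤ β * g → e * g ≤ f * f → γ * h ≤ e * g →
    -- (3)
    γ * g ≤ α * e → γ * g ≤ e * f → γ * g ≤ β * f →
    -- (4)
    γ * f ≤ β * e → β * h ≤ α * g → f * h ≤ g * g → e * h ≤ f * g →
    StronglyQLogConvex R (Apoly R α β γ e f g h)
-- The second copies of 0 ≤ g and 0 ≤ h, in (1), are redundant.
mainTheorem3 R α β γ e f g h 0≤α 0≤β 0≤γ 0≤e 0≤f 0≤g 0≤h α≤f β≤e _ _
             βg≤αf γh≤βg eg≤ff γh≤eg γg≤αe γg≤ef γg≤βf γf≤βe βh≤αg fh≤gg eh≤fg =
  StronglyQLogConvex-cong (λ n k → sym (Apoly≈a n k))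
    (stronglyQLogConvex P-nonNeg P-lowerBanded P-TP₂ (P-diagonallyIncreasing α≤f β≤e) a₀≼a₁
                        (λ n → suc (2 ℕ.* n) , a-vanishesFrom n))
  where
  open OrderedCommutativeRing R using (sym)
  open Polynomials R using (StronglyQLogConvex-cong)
  open Array R α β γ e f g h
  open ProductionMatrices R P 3
  open Rows a a-step
  open NonNegativeEntries 0≤α 0≤β 0≤γ 0≤e 0≤f 0≤g 0≤h
  open TotallyPositive β≤e βg≤αf γh≤βg eg≤ff γh≤eg γg≤αe γg≤ef γg≤βf γf≤βe βh≤αg fh≤gg eh≤fg
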